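{- For every positive integer $n$, the number of tuples $d\in\mathbb{Z}_+^n$ that are cyclic hyper degrees is at least $2^{\frac{(n-1)(n-2)}{2}}$.
   Context: $\mathbb{Z}_+$ denotes the nonnegative integers. For $m\ge0$ and $i\ge1$, $\mathrm{bin}(m,i)$ is the $i$-th bit of $m$ counted from the least significant bit. For $i\in[n]$, $c_{i,n}$ is the list of length $2^n$ with $c_{i,n}(j)=\mathrm{bin}(j-1,i)$. A cyclic permutation of order $k\ge0$ on $[m]$ is the map $i\mapsto 1+((i+k-1)\bmod m)$. For a list $\Pi=(\pi_1,\dots,\pi_n)$ of cyclic permutations of $[2^n]$ and $i\in[2^n]$, let $\Pi(T_n,i)=(c_{n,n}(\pi_n(i)),c_{n-1,n}(\pi_{n-1}(i)),\dots,c_{1,n}(\pi_1(i)))\in\{0,1\}^n$. A tuple $d\in\mathbb{Z}_+^n$ is a cyclic hyper degree if there exist such a list $\Pi$ and indices $i\le N$ in $[2^n]$ with $d=\sum_{k=i}^{N}\Pi(T_n,k)$. -}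

module Defs where

open import Data.Nat using (ℕ; zero; suc; _+_; _*_; _∸_; _^_; _≤_; NonZero)
open import Data.Nat.DivMod using (_/_; _%_)
open import Data.Nat.Properties using (m^n≢0)
open import Data.Fin using (Fin; toℕ; opposite)
open import Data.Vec using (Vec; tabulate; lookup)
open import Data.Product using (Σ; _×_)
open import Relation.Binary.PropositionalEquality using (_≡_)

pow2≢0 : ∀ n → NonZero (2 ^ n)
pow2≢0 n = m^n≢0 2 n

-- bin(m,i): the i-th bit of m (i ≥ 1), counted from the least significant bit
bin : ℕ → ℕ → ℕ
bin m i = (_/_ m (2 ^ (i ∸ 1)) {{pow2≢0 (i ∸ 1)}}) % 2

c : ℕ → ℕ → ℕ → ℕ
c i n j = bin (j ∸ 1) i

-- cyclic permutation of order k on [m] (m = 2^n):  i ↦ 1 + ((i+k-1) mod m)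
cycPerm : (n k i : ℕ) → ℕ
cycPerm n k i = suc (_%_ ((i + k) ∸ 1) (2 ^ n) {{pow2≢0 n}})

-- Σ_{k=i}^{N} f k  (empty if N < i)
sumFromTo : ℕ → ℕ → (ℕ → ℕ) → ℕ
sumFromTo i N f = go (suc N ∸ i)
  where
  go : ℕ → ℕ
  go zero    = 0
  go (suc t) = go t + f (i + t)

-- A list Π = (π_1,…,π_n) of cyclic permutations of [2^n] is given by their
-- orders:  ord : Vec ℕ n  with  π_{t+1} = cycPerm n (lookup ord t).
-- Π(T_n, i) : position p (0-based) holds  c_{n-p,n}(π_{n-p}(i)),
-- i.e. the tuple (c_{n,n}(π_n(i)), …, c_{1,n}(π_1(i))).
PiT : (n : ℕ) → Vec ℕ n → ℕ → Vec ℕ n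
PiT n ord i = tabulate λ p →
  c (suc (toℕ (opposite p))) n (cycPerm n (lookup ord (opposite p)) i)

hyperDeg : (n : ℕ) → Vec ℕ n → ℕ → ℕ → Vec ℕ n
hyperDeg n ord i N = tabulate λ p → sumFromTo i N (λ k → lookup (PiT n ord k) p)

IsCyclicHyperDegree : (n : ℕ) → Vec ℕ n → Set
IsCyclicHyperDegree n d =
  Σ (Vec ℕ n) λ ord → Σ ℕ λ i → Σ ℕ λ N →
    (1 ≤ i) × (i ≤ N) × (N ≤ 2 ^ n) × (d ≡ hyperDeg n ord i N)

module Submission where

-- For n ≥ 2 every tuple is produced with the same index range
-- k = 1, …, L, where L = alt n has binary digits 1010…10.  Coordinate p of
-- Σ_k Π(T_n,k) then counts the points y of the cyclic window o, o+1, …, o+L-1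
-- (mod 2^n) whose bit b = n-1-p is set, o being the order of π_{b+1}; since
-- each coordinate has its own permutation, the coordinates can be chosen
-- independently of each other (independent-columns).
-- Shifting a window by one changes its count by bit_b(o+L) - bit_b(o)
-- (window-slide).  As L ≡ alt(b+1) (mod 2^{b+1}) and 2^{b+1} ≤ 3·alt(b+1)+2 ≤
-- 2^{b+2}, there is a run of at least 2^{b-1} - 1 consecutive orders on which
-- every shift adds exactly one, so coordinate p takes at least 2^{b-1}
-- consecutive values.  The product of these value lists (box) is a list of
-- distinct cyclic hyper degrees of length ≥ 2^{Σ_{b<n}(b-1)} = 2^{(n-1)(n-2)/2}.

open import Defs
open import Data.Nat
  using (ℕ; zero; suc; _+_; _*_; _∸_; _^_; _≤_; _<_; _⊓_; _≤?_; z≤n; s≤s; _/_; _%_)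
open import Data.Nat.Properties
open import Algebra.Properties.CommutativeSemigroup +-commutativeSemigroup
  using () renaming (xy∙z≈xz∙y to +-right-comm)
open import Data.Nat.DivMod
  using ( m%[n*o]/o≡m/o%n; m∣n⇒o%n%m≡o%m; m<n⇒m/n≡0; m/n≡1+[m∸n]/n
        ; [m+kn]%n≡m%n; m*n/n≡m)
open import Data.Nat.Divisibility using (_∣_; divides)
open import Data.Nat.Tactic.RingSolver using (solve-∀)
open import Data.Fin using (Fin; toℕ; opposite)
import Data.Fin as Fin
open import Data.Fin.Properties using (opposite-prop; opposite-involutive; toℕ<n)
open import Data.Product using (Σ; ∃; _×_; _,_; proj₁; proj₂)
open import Data.List using (List; []; _∷_; length; map; _++_; applyUpTo; cartesianProductWith)
open import Data.List.Properties using (length-++; length-map; length-applyUpTo)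
open import Data.List.Membership.Propositional using (_∈_)
open import Data.List.Membership.Propositional.Properties
  using (∈-cartesianProductWith⁻; ∈-applyUpTo⁻)
open import Data.List.Relation.Unary.All using (All; []; _∷_)
import Data.List.Relation.Unary.All as All
open import Data.List.Relation.Unary.AllPairs using ([]; _∷_)
open import Data.List.Relation.Unary.Unique.Propositional using (Unique)
import Data.List.Relation.Unary.Unique.Propositional.Properties as Unique
open import Data.Vec using (Vec; []; _∷_; lookup; tabulate)
open import Data.Vec.Properties using (∷-injective; lookup∘tabulate; tabulate∘lookup; tabulate-cong)
open import Relation.Nullary using (yes; no)
open import Relation.Binary.PropositionalEquality
  using (_≡_; refl; sym; trans; cong; cong₂; subst; module ≡-Reasoning)

_mod2^_ : ℕ → ℕ → ℕ
y mod2^ k = _%_ y (2 ^ k) {{pow2≢0 k}}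

_div2^_ : ℕ → ℕ → ℕ
y div2^ k = _/_ y (2 ^ k) {{pow2≢0 k}}

infixl 7 _mod2^_ _div2^_

pow-double : ∀ k → 2 ^ k + 2 ^ k ≡ 2 ^ suc k
pow-double k = cong (2 ^ k +_) (sym (+-identityʳ (2 ^ k)))

pow-∣ : ∀ {k n} → k ≤ n → 2 ^ k ∣ 2 ^ n
pow-∣ {k} {n} k≤n = divides (2 ^ (n ∸ k)) (begin
    2 ^ n               ≡⟨ cong (2 ^_) (sym (m+[n∸m]≡n k≤n)) ⟩
    2 ^ (k + (n ∸ k))   ≡⟨ ^-distribˡ-+-* 2 k (n ∸ k) ⟩
    2 ^ k * 2 ^ (n ∸ k) ≡⟨ *-comm (2 ^ k) _ ⟩
    2 ^ (n ∸ k) * 2 ^ k ∎)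
  where open ≡-Reasoning

parity : ℕ → ℕ
parity zero          = 0
parity (suc zero)    = 1
parity (suc (suc m)) = parity m

-- alt m = Σ_{j<m} parity(j)·2^j, the m-digit binary number 1010…10.
alt : ℕ → ℕ
alt zero    = 0
alt (suc m) = alt m + parity m * 2 ^ m

-- Two more digits shift the old ones up and append 10.
alt-step : ∀ m → alt (2 + m) ≡ 4 * alt m + 2
alt-step zero    = refl
alt-step (suc m) = begin
    alt (2 + m) + parity m * 2 ^ (2 + m)      ≡⟨ cong (_+ parity m * 2 ^ (2 + m)) (alt-step m) ⟩
    4 * alt m + 2 + parity m * 2 ^ (2 + m)    ≡⟨ regroup (alt m) (parity m) (2 ^ m) ⟩
    4 * (alt m + parity m * 2 ^ m) + 2        ∎
  where
  open ≡-Reasoning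
  regroup : ∀ a p x → 4 * a + 2 + p * (2 * (2 * x)) ≡ 4 * (a + p * x) + 2
  regroup = solve-∀

alt-lower : ∀ m → 2 ^ m ≤ 3 * alt m + 2
alt-lower zero          = s≤s z≤n
alt-lower (suc zero)    = ≤-refl
alt-lower (suc (suc m)) rewrite alt-step m = begin
    2 * (2 * 2 ^ m)       ≡⟨ *-assoc 2 2 (2 ^ m) ⟨
    4 * 2 ^ m             ≤⟨ *-monoʳ-≤ 4 (alt-lower m) ⟩
    4 * (3 * alt m + 2)   ≡⟨ regroup (alt m) ⟩
    3 * (4 * alt m + 2) + 2 ∎
  where
  open ≤-Reasoning
  regroup : ∀ a → 4 * (3 * a + 2) ≡ 3 * (4 * a + 2) + 2
  regroup = solve-∀

alt-upper : ∀ m → 3 * alt m + 2 ≤ 2 * 2 ^ m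
alt-upper zero          = ≤-refl
alt-upper (suc zero)    = s≤s (s≤s z≤n)
alt-upper (suc (suc m)) rewrite alt-step m = begin
    3 * (4 * alt m + 2) + 2 ≡⟨ regroup (alt m) ⟩
    4 * (3 * alt m + 2)     ≤⟨ *-monoʳ-≤ 4 (alt-upper m) ⟩
    4 * (2 * 2 ^ m)         ≡⟨ *-assoc 2 2 (2 * 2 ^ m) ⟩
    2 * (2 * (2 * 2 ^ m))   ∎
  where
  open ≤-Reasoning
  regroup : ∀ a → 3 * (4 * a + 2) + 2 ≡ 4 * (3 * a + 2)
  regroup = solve-∀

-- alt m has m digits; in particular L = alt n is an admissible index range.
alt<pow : ∀ m → alt m < 2 ^ m
alt<pow m = *-cancelˡ-< 3 (alt m) (2 ^ m) (begin-strict
    3 * alt m     <⟨ m<m+n (3 * alt m) (s≤s z≤n) ⟩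
    3 * alt m + 2 ≤⟨ alt-upper m ⟩
    2 * 2 ^ m     ≤⟨ *-monoˡ-≤ (2 ^ m) (n≤1+n 2) ⟩
    3 * 2 ^ m     ∎)
  where open ≤-Reasoning

alt-positive : ∀ m → 1 ≤ alt (2 + m)
alt-positive m = subst (1 ≤_) (sym (alt-step m)) (≤-trans (s≤s z≤n) (m≤n+m 2 (4 * alt m)))

alt-prefix : ∀ k d → ∃ λ q → alt (k + d) ≡ alt k + q * 2 ^ k
alt-prefix k zero    = 0 , trans (cong alt (+-identityʳ k)) (sym (+-identityʳ (alt k)))
alt-prefix k (suc d) with alt-prefix k d
... | q , eq = q + parity (k + d) * 2 ^ d , (begin
    alt (k + suc d)                                ≡⟨ cong alt (+-suc k d) ⟩
    alt (k + d) + parity (k + d) * 2 ^ (k + d)     ≡⟨ cong₂ _+_ eq (cong (parity (k + d) *_) (^-distribˡ-+-* 2 k d)) ⟩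
    alt k + q * 2 ^ k + parity (k + d) * (2 ^ k * 2 ^ d) ≡⟨ regroup (alt k) q (2 ^ k) (parity (k + d)) (2 ^ d) ⟩
    alt k + (q + parity (k + d) * 2 ^ d) * 2 ^ k   ∎)
  where
  open ≡-Reasoning
  regroup : ∀ a q x p y → a + q * x + p * (x * y) ≡ a + (q + p * y) * x
  regroup = solve-∀

alt-congruent : ∀ {k n} → k ≤ n → ∀ x → (alt n + x) mod2^ k ≡ (alt k + x) mod2^ k
alt-congruent {k} {n} k≤n x with alt-prefix k (n ∸ k)
... | q , eq = begin
    (alt n + x) mod2^ k                 ≡⟨ cong (λ m → (alt m + x) mod2^ k) (sym (m+[n∸m]≡n k≤n)) ⟩
    (alt (k + (n ∸ k)) + x) mod2^ k     ≡⟨ cong (λ a → (a + x) mod2^ k) eq ⟩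
    (alt k + q * 2 ^ k + x) mod2^ k     ≡⟨ cong (_mod2^ k) (+-right-comm (alt k) (q * 2 ^ k) x) ⟩
    (alt k + x + q * 2 ^ k) mod2^ k     ≡⟨ [m+kn]%n≡m%n (alt k + x) q (2 ^ k) {{pow2≢0 k}} ⟩
    (alt k + x) mod2^ k                 ∎
  where open ≡-Reasoning

-- For
-- x = 2^{b-1} and r = alt (b+1), alt-lower and alt-upper give both hypotheses:
-- r and 2^{b+1} - r are at least 2^{b-1} - 1.
quarter-bound : ∀ x r → 2 * (2 * x) ≤ 3 * r + 2 → x ≤ r
quarter-bound x r h = ≤-pred (*-cancelˡ-< 3 x (suc r) (begin-strict
    3 * x         ≤⟨ *-monoˡ-≤ x (n≤1+n 3) ⟩
    4 * x         ≡⟨ *-assoc 2 2 x ⟩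
    2 * (2 * x)   ≤⟨ h ⟩
    3 * r + 2     <⟨ +-monoʳ-< (3 * r) (n<1+n 2) ⟩
    3 * r + 3     ≡⟨ regroup r ⟩
    3 * suc r     ∎))
  where
  open ≤-Reasoning
  regroup : ∀ r → 3 * r + 3 ≡ 3 * suc r
  regroup = solve-∀

three-quarter-bound : ∀ x r → 3 * r + 2 ≤ 2 * (2 * (2 * x)) → x ≤ suc (2 * (2 * x) ∸ r)
three-quarter-bound zero    r h = z≤n
three-quarter-bound (suc y) r h = s≤s (m+n≤o⇒m≤o∸n y (begin
    y + r                      ≤⟨ +-monoʳ-≤ y r≤ ⟩
    y + (3 * suc y + 1)        ≡⟨ regroup y ⟩
    2 * (2 * suc y)            ∎))
  where
  open ≤-Reasoning
  regroup : ∀ y → y + (3 * suc y + 1) ≡ 2 * (2 * suc y)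
  regroup = solve-∀
  widen : ∀ y → 2 * (2 * (2 * suc y)) + (y + 7) ≡ 3 * suc (3 * suc y + 1)
  widen = solve-∀
  -- from 3r < 8x ≤ 9x + 6 with x = 1 + y
  r≤ : r ≤ 3 * suc y + 1
  r≤ = ≤-pred (*-cancelˡ-< 3 r _ (begin-strict
    3 * r                          <⟨ m<m+n (3 * r) (s≤s z≤n) ⟩
    3 * r + 2                      ≤⟨ h ⟩
    2 * (2 * (2 * suc y))          ≤⟨ m≤m+n _ (y + 7) ⟩
    2 * (2 * (2 * suc y)) + (y + 7) ≡⟨ widen y ⟩
    3 * suc (3 * suc y + 1)        ∎))

-- Bit b of y only depends on y mod 2^{b+1}, of which it is the top digit.
bin-as-mod : ∀ y b → bin y (suc b) ≡ y mod2^ suc b div2^ b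
bin-as-mod y b = sym (m%[n*o]/o≡m/o%n y 2 (2 ^ b) {{_}} {{pow2≢0 b}} {{pow2≢0 (suc b)}})

bin-cong-mod : ∀ {y z} b → y mod2^ suc b ≡ z mod2^ suc b → bin y (suc b) ≡ bin z (suc b)
bin-cong-mod {y} {z} b eq = begin
    bin y (suc b)         ≡⟨ bin-as-mod y b ⟩
    y mod2^ suc b div2^ b ≡⟨ cong (_div2^ b) eq ⟩
    z mod2^ suc b div2^ b ≡⟨ bin-as-mod z b ⟨
    bin z (suc b)         ∎
  where open ≡-Reasoning

bin-mod-pow : ∀ y {b n} → b < n → bin (y mod2^ n) (suc b) ≡ bin y (suc b)
bin-mod-pow y {b} {n} b<n = bin-cong-mod b
  (m∣n⇒o%n%m≡o%m (2 ^ suc b) (2 ^ n) y {{pow2≢0 (suc b)}} {{pow2≢0 n}} (pow-∣ b<n))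

bin-below : ∀ {y} b → y < 2 ^ b → bin y (suc b) ≡ 0
bin-below b y<h = cong (_% 2) (m<n⇒m/n≡0 {{pow2≢0 b}} y<h)

bin-top : ∀ {y} b → 2 ^ b ≤ y → y < 2 ^ b + 2 ^ b → bin y (suc b) ≡ 1
bin-top {y} b h≤y y<2h = cong (_% 2) (begin
    y div2^ b                    ≡⟨ m/n≡1+[m∸n]/n {{pow2≢0 b}} h≤y ⟩
    1 + (y ∸ 2 ^ b) div2^ b      ≡⟨ cong suc (m<n⇒m/n≡0 {{pow2≢0 b}} (m<n+o⇒m∸n<o y (2 ^ b) {{pow2≢0 b}} y<2h)) ⟩
    1                            ∎)
  where open ≡-Reasoning

cycBit : (n b y : ℕ) → ℕ
cycBit n b y = bin (y mod2^ n) (suc b)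

window : (ℕ → ℕ) → ℕ → ℕ → ℕ
window f o t = sumFromTo 1 t (λ k → f (k + o ∸ 1))

sumFromTo-cong : ∀ N {f g : ℕ → ℕ} → (∀ k → f k ≡ g k) → sumFromTo 1 N f ≡ sumFromTo 1 N g
sumFromTo-cong zero    eq = refl
sumFromTo-cong (suc N) eq = cong₂ _+_ (sumFromTo-cong N eq) (eq (suc N))

window-slide : ∀ f o t → window f (suc o) t + f o ≡ window f o t + f (t + o)
window-slide f o zero    = refl
window-slide f o (suc t) = begin
    window f (suc o) t + f (t + suc o) + f o ≡⟨ +-right-comm (window f (suc o) t) _ _ ⟩
    window f (suc o) t + f o + f (t + suc o) ≡⟨ cong₂ _+_ (window-slide f o t) (cong f (+-suc t o)) ⟩
    window f o t + f (t + o) + f (suc (t + o)) ∎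
  where open ≡-Reasoning

window-run : ∀ f o t m → (∀ j → j < m → f (o + j) ≡ 0 × f (t + (o + j)) ≡ 1) →
             ∀ j → j ≤ m → window f (o + j) t ≡ window f o t + j
window-run f o t m run zero    _   = trans (cong (λ o′ → window f o′ t) (+-identityʳ o)) (sym (+-identityʳ _))
window-run f o t m run (suc j) j<m = begin
    window f (o + suc j) t                 ≡⟨ cong (λ o′ → window f o′ t) (+-suc o j) ⟩
    window f (suc (o + j)) t               ≡⟨ sym (+-identityʳ _) ⟩
    window f (suc (o + j)) t + 0           ≡⟨ cong (window f (suc (o + j)) t +_) (sym (proj₁ (run j j<m))) ⟩
    window f (suc (o + j)) t + f (o + j)   ≡⟨ window-slide f (o + j) t ⟩
    window f (o + j) t + f (t + (o + j))   ≡⟨ cong₂ _+_ (window-run f o t m run j (<⇒≤ j<m)) (proj₂ (run j j<m)) ⟩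
    window f o t + j + 1                   ≡⟨ +-comm (window f o t + j) 1 ⟩
    suc (window f o t + j)                 ≡⟨ +-suc (window f o t) j ⟨
    window f o t + suc j                   ∎
  where open ≡-Reasoning

-- The coordinates of a hyper degree with index range 1..N can be prescribed
-- independently: coordinate p is a window sum of bit (opposite p), and its
-- offset is the order of the permutation π_{opposite p + 1}.
independent-columns : ∀ n N → 1 ≤ N → N ≤ 2 ^ n → (v : Vec ℕ n) →
  (∀ p → ∃ λ o → lookup v p ≡ window (cycBit n (toℕ (opposite p))) o N) →
  IsCyclicHyperDegree n v
independent-columns n N 1≤N N≤2ⁿ v column =
  ord , 1 , N , ≤-refl , 1≤N , N≤2ⁿ , trans (sym (tabulate∘lookup v)) (tabulate-cong coordinate)
  where
  ord : Vec ℕ n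
  ord = tabulate (λ q → proj₁ (column (opposite q)))
  order-at : ∀ p → lookup ord (opposite p) ≡ proj₁ (column p)
  order-at p = trans (lookup∘tabulate _ (opposite p)) (cong (λ q → proj₁ (column q)) (opposite-involutive p))
  coordinate : ∀ p → lookup v p ≡ sumFromTo 1 N (λ k → lookup (PiT n ord k) p)
  coordinate p = begin
      lookup v p                                  ≡⟨ proj₂ (column p) ⟩
      window bit (proj₁ (column p)) N             ≡⟨ cong (λ o → window bit o N) (sym (order-at p)) ⟩
      window bit (lookup ord (opposite p)) N      ≡⟨ sumFromTo-cong N (λ k → sym (lookup∘tabulate _ p)) ⟩
      sumFromTo 1 N (λ k → lookup (PiT n ord k) p) ∎
    where
    open ≡-Reasoning
    bit : ℕ → ℕ
    bit = cycBit n (toℕ (opposite p))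

-- box col k lists the vectors (x_{k-1}, …, x_0) with x_b ∈ col b.
box : {A : Set} → (ℕ → List A) → (k : ℕ) → List (Vec A k)
box col zero    = [] ∷ []
box col (suc k) = cartesianProductWith _∷_ (col k) (box col k)

length-cartesianProductWith : ∀ {A B C : Set} (f : A → B → C) xs ys →
  length (cartesianProductWith f xs ys) ≡ length xs * length ys
length-cartesianProductWith f []       ys = refl
length-cartesianProductWith f (x ∷ xs) ys =
  trans (length-++ (map (f x) ys))
        (cong₂ _+_ (length-map (f x) ys) (length-cartesianProductWith f xs ys))

box-unique : ∀ {A : Set} {col : ℕ → List A} → (∀ b → Unique (col b)) → ∀ k → Unique (box col k)
box-unique uniq zero    = [] ∷ []
box-unique uniq (suc k) = Unique.cartesianProductWith⁺ _∷_ ∷-injective (uniq k) (box-unique uniq k)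

box-∈ : ∀ {A : Set} {col : ℕ → List A} k {v} → v ∈ box col k →
        ∀ p → lookup v p ∈ col (k ∸ suc (toℕ p))
box-∈ {col = col} (suc k) v∈ p with ∈-cartesianProductWith⁻ _∷_ (col k) (box col k) v∈
box-∈ (suc k) v∈ Fin.zero    | x , w , x∈ , w∈ , refl = x∈
box-∈ (suc k) v∈ (Fin.suc p) | x , w , x∈ , w∈ , refl = box-∈ k w∈ p

sumBelow : (ℕ → ℕ) → ℕ → ℕ
sumBelow e zero    = 0
sumBelow e (suc k) = e k + sumBelow e k

box-length : ∀ {A : Set} {col : ℕ → List A} (e : ℕ → ℕ) → (∀ b → 2 ^ e b ≤ length (col b)) →
             ∀ k → 2 ^ sumBelow e k ≤ length (box col k)
box-length e big zero    = ≤-refl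
box-length {col = col} e big (suc k) = begin
    2 ^ (e k + sumBelow e k)               ≡⟨ ^-distribˡ-+-* 2 (e k) (sumBelow e k) ⟩
    2 ^ e k * 2 ^ sumBelow e k             ≤⟨ *-mono-≤ (big k) (box-length e big k) ⟩
    length (col k) * length (box col k)    ≡⟨ length-cartesianProductWith _∷_ (col k) (box col k) ⟨
    length (box col (suc k))               ∎
  where open ≤-Reasoning

sumBelow-pred : ∀ k → sumBelow (_∸ 1) k * 2 ≡ (k ∸ 1) * (k ∸ 2)
sumBelow-pred zero          = refl
sumBelow-pred (suc zero)    = refl
sumBelow-pred (suc (suc k)) = begin
    (k + sumBelow (_∸ 1) (suc k)) * 2     ≡⟨ *-distribʳ-+ 2 k _ ⟩
    k * 2 + sumBelow (_∸ 1) (suc k) * 2   ≡⟨ cong (k * 2 +_) (sumBelow-pred (suc k)) ⟩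
    k * 2 + k * (k ∸ 1)                   ≡⟨ triangle k ⟩
    suc k * k                             ∎
  where
  open ≡-Reasoning
  triangle : ∀ k → k * 2 + k * (k ∸ 1) ≡ suc k * k
  triangle zero    = refl
  triangle (suc m) = regroup m
    where
    regroup : ∀ m → suc m * 2 + suc m * m ≡ suc (suc m) * suc m
    regroup = solve-∀

-- For r < 2h, the offsets x = (h ∸ r) + j with j < min(r, 2h - r) satisfy
-- x < h ≤ r + x < 2h: bit b (h = 2^b) of x is 0 and that of r + x is 1.
run-offsets : ∀ h r j → r < h + h → j < r ⊓ (h + h ∸ r) →
  (h ∸ r) + j < h × h ≤ r + ((h ∸ r) + j) × r + ((h ∸ r) + j) < h + h
run-offsets h r j r<2h j<M with r ≤? h
... | yes r≤h = x<h , subst (h ≤_) (sym r+x) (m≤m+n h j) , subst (_< h + h) (sym r+x) (+-monoʳ-< h j<h)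
  where
  j<r : j < r
  j<r = <-≤-trans j<M (m⊓n≤m _ _)
  j<h : j < h
  j<h = <-≤-trans j<r r≤h
  x<h : (h ∸ r) + j < h
  x<h = subst ((h ∸ r) + j <_) (m∸n+n≡m r≤h) (+-monoʳ-< (h ∸ r) j<r)
  r+x : r + ((h ∸ r) + j) ≡ h + j
  r+x = trans (sym (+-assoc r (h ∸ r) j)) (cong (_+ j) (m+[n∸m]≡n r≤h))
... | no r≰h = subst (λ a → a + j < h × h ≤ r + (a + j) × r + (a + j) < h + h)
                    (sym (m≤n⇒m∸n≡0 (<⇒≤ h<r)))
                    (j<h , ≤-trans (<⇒≤ h<r) (m≤m+n r j) , r+j<2h)
  where
  h<r : h < r
  h<r = ≰⇒> r≰h
  j<2h-r : j < h + h ∸ r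
  j<2h-r = <-≤-trans j<M (m⊓n≤n _ _)
  j<h : j < h
  j<h = <-≤-trans j<2h-r (subst (h + h ∸ r ≤_) (m+n∸m≡n h h) (∸-monoʳ-≤ (h + h) (<⇒≤ h<r)))
  r+j<2h : r + j < h + h
  r+j<2h = subst (r + j <_) (m+[n∸m]≡n (<⇒≤ r<2h)) (+-monoʳ-< r j<2h-r)

module AlternatingWindow (n : ℕ) where

  L : ℕ
  L = alt n

  -- L mod 2^{b+1}, for b < n
  residue : ℕ → ℕ
  residue b = alt (suc b)

  start : ℕ → ℕ
  start b = 2 ^ b ∸ residue b

  runLength : ℕ → ℕ
  runLength b = residue b ⊓ (2 ^ b + 2 ^ b ∸ residue b)

  runLength-bound : ∀ b → 2 ^ (b ∸ 1) ≤ suc (runLength b)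
  runLength-bound zero    = s≤s z≤n
  runLength-bound (suc c) = ⊓-glb
    (≤-trans (quarter-bound (2 ^ c) (residue (suc c)) (alt-lower (2 + c))) (n≤1+n _))
    (subst (λ m → 2 ^ c ≤ suc (m ∸ residue (suc c))) (sym (pow-double (suc c)))
      (three-quarter-bound (2 ^ c) (residue (suc c)) (alt-upper (2 + c))))

  run-bits : ∀ {b} → b < n → ∀ j → j < runLength b →
    cycBit n b (start b + j) ≡ 0 × cycBit n b (L + (start b + j)) ≡ 1
  run-bits {b} b<n j j<M with run-offsets (2 ^ b) (residue b) j r<2h j<M
    where
    r<2h : residue b < 2 ^ b + 2 ^ b
    r<2h = subst (residue b <_) (sym (pow-double b)) (alt<pow (suc b))
  ... | x<h , h≤r+x , r+x<2h =
      trans (bin-mod-pow x b<n) (bin-below b x<h)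
    , (begin
        cycBit n b (L + x)         ≡⟨ bin-mod-pow (L + x) b<n ⟩
        bin (L + x) (suc b)        ≡⟨ bin-cong-mod b (alt-congruent b<n x) ⟩
        bin (residue b + x) (suc b) ≡⟨ bin-top b h≤r+x r+x<2h ⟩
        1                          ∎)
    where
    open ≡-Reasoning
    x = start b + j

  lowest : ℕ → ℕ
  lowest b = window (cycBit n b) (start b) L

  values : ℕ → List ℕ
  values b = applyUpTo (lowest b +_) (suc (runLength b))

  values-achievable : ∀ {b v} → b < n → v ∈ values b → ∃ λ o → v ≡ window (cycBit n b) o L
  values-achievable {b} b<n v∈ with ∈-applyUpTo⁻ (lowest b +_) v∈
  ... | j , j≤M , refl =
    start b + j , sym (window-run (cycBit n b) (start b) L (runLength b) (run-bits b<n) j (≤-pred j≤M))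

  values-unique : ∀ b → Unique (values b)
  values-unique b = Unique.applyUpTo⁺₁ (lowest b +_) _
    (λ i<j _ eq → <⇒≢ i<j (+-cancelˡ-≡ (lowest b) _ _ eq))

  values-length : ∀ b → 2 ^ (b ∸ 1) ≤ length (values b)
  values-length b = subst (2 ^ (b ∸ 1) ≤_) (sym (length-applyUpTo (lowest b +_) (suc (runLength b))))
    (runLength-bound b)

lemma20 : (n : ℕ) → 1 ≤ n →
    Σ (List (Vec ℕ n)) λ ds →
    Unique ds × All (IsCyclicHyperDegree n) ds
    × (2 ^ (((n ∸ 1) * (n ∸ 2)) / 2) ≤ length ds)
-- n = 1: a single hyper degree suffices.
lemma20 (suc zero) _ =
  hyperDeg 1 (0 ∷ []) 1 1 ∷ [] , [] ∷ [] , ((0 ∷ []) , 1 , 1 , ≤-refl , ≤-refl , s≤s z≤n , refl) ∷ [] , ≤-refl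
lemma20 n@(suc (suc m)) _ = box values n , box-unique values-unique n , All.tabulate hyper-degree , enough
  where
  open AlternatingWindow n
  hyper-degree : ∀ {v} → v ∈ box values n → IsCyclicHyperDegree n v
  hyper-degree {v} v∈ = independent-columns n L (alt-positive m) (<⇒≤ (alt<pow n)) v λ p →
    values-achievable (toℕ<n (opposite p))
      (subst (λ b → lookup v p ∈ values b) (sym (opposite-prop p)) (box-∈ {col = values} n v∈ p))
  enough : 2 ^ (((n ∸ 1) * (n ∸ 2)) / 2) ≤ length (box values n)
  enough = begin
    2 ^ (((n ∸ 1) * (n ∸ 2)) / 2)          ≡⟨ cong (λ e → 2 ^ (e / 2)) (sym (sumBelow-pred n)) ⟩
    2 ^ (sumBelow (_∸ 1) n * 2 / 2)        ≡⟨ cong (2 ^_) (m*n/n≡m (sumBelow (_∸ 1) n) 2) ⟩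
    2 ^ sumBelow (_∸ 1) n                  ≤⟨ box-length (_∸ 1) values-length n ⟩
    length (box values n)                  ∎
    where open ≤-Reasoning
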